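{- Let $A$ be a finite set of actions partitioned as $A=A^l\uplus A^r$, with $\mathcal{P}$, $\lesssim_{cc}$, $\mathcal{L}$, $\models$, $\equiv$, characteristic formulae and representation as in the context; for $p\in\mathcal{P}$ let $\chi(p)$ denote a characteristic formula of $p$ (which exists and is unique up to $\equiv$). Then: (1) For $p\in\mathcal{P}$ and $\phi\in\mathcal{L}$, $p$ represents $\phi$ if and only if $\phi\equiv\chi(p)$. (2) For every finite $M\subseteq\mathcal{P}$ and $\phi\in\mathcal{L}$, $M$ represents $\phi$ if and only if $\phi\equiv\bigvee_{p\in M}\chi(p)$ (the empty disjunction being $\bot$).
   Context: Process terms over $A$ are given by $p::=0\mid\omega\mid a.p\mid p+p$ with $a\in A$; the set of process terms is $\mathcal{P}$. Their transitions are the least relation satisfying: $\omega\xrightarrow{b}\omega$ for every $b\in A^l$; $a.p\xrightarrow{a}p$ for every $a\in A$; if $p\xrightarrow{a}p'$ then $p+q\xrightarrow{a}p'$ and $q+p\xrightarrow{a}p'$. A covariant-contravariant simulation is a relation $R\subseteq\mathcal{P}\times\mathcal{P}$ such that whenever $p\,R\,q$: for all $a\in A^r$ and all $p\xrightarrow{a}p'$ there is $q\xrightarrow{a}q'$ with $p'\,R\,q'$; and for all $b\in A^l$ and all $q\xrightarrow{b}q'$ there is $p\xrightarrow{b}p'$ with $p'\,R\,q'$. Write $p\lesssim_{cc}q$ iff some covariant-contravariant simulation contains $(p,q)$. The logic $\mathcal{L}$ has syntax $\varphi::=\bot\mid\top\mid\varphi\land\varphi\mid\varphi\lor\varphi\mid[b]\varphi\mid\langle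 a\rangle\varphi$ with $a\in A^r$, $b\in A^l$; $\bot,\top,\land,\lor$ have the usual meaning, $p\models[b]\varphi$ iff $p'\models\varphi$ for all $p\xrightarrow{b}p'$, and $p\models\langle a\rangle\varphi$ iff $p'\models\varphi$ for some $p\xrightarrow{a}p'$. $\phi\equiv\psi$ means that $\phi$ and $\psi$ are satisfied by exactly the same $p\in\mathcal{P}$. A formula $\phi$ is a characteristic formula for $p\in\mathcal{P}$ iff $p\models\phi$ and for all $q\in\mathcal{P}$, $q\models\phi$ implies $p\lesssim_{cc}q$. A formula $\phi$ is represented by a process $p\in\mathcal{P}$ iff for all $q\in\mathcal{P}$: $q\models\phi\iff p\lesssim_{cc}q$. A formula $\phi$ is represented by a finite set $M\subseteq\mathcal{P}$ iff for all $q\in\mathcal{P}$: $q\models\phi\iff\exists p\in M.\ p\lesssim_{cc}q$. -}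

module Defs where

open import Level using (Level) renaming (suc to lsuc; zero to lzero)
open import Data.Nat using (ℕ)
open import Data.Fin using (Fin)
open import Data.List using (List; []; _∷_; foldr; map)
open import Data.List.Membership.Propositional using (_∈_)
open import Data.Product using (Σ; ∃; ∃-syntax; _×_; _,_)
open import Data.Sum using (_⊎_)
open import Data.Unit using (⊤)
open import Data.Empty using () renaming (⊥ to Empty)
open import Relation.Binary.PropositionalEquality using (_≡_)
open import Function.Bundles using (_⇔_)

data Pol : Set where
  l r : Pol

-- The finite action set A is Fin n; pol says whether an action is in A^l or A^r.
module CC (n : ℕ) (pol : Fin n → Pol) where

  Act : Set
  Act = Fin n

  data Proc : Set where
    nil   : Proc
    omega : Proc
    _∙_   : Act → Proc → Proc
    _⊕_   : Proc → Proc → Proc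

  data _—[_]→_ : Proc → Act → Proc → Set where
    ω-step : ∀ b → pol b ≡ l → omega —[ b ]→ omega
    pre    : ∀ a p → (a ∙ p) —[ a ]→ p
    sumˡ   : ∀ {p p' a} q → p —[ a ]→ p' → (p ⊕ q) —[ a ]→ p'
    sumʳ   : ∀ {p p' a} q → p —[ a ]→ p' → (q ⊕ p) —[ a ]→ p'

  IsCCSim : (Proc → Proc → Set) → Set
  IsCCSim R = ∀ p q → R p q →
      (∀ a → pol a ≡ r → ∀ p' → p —[ a ]→ p' → ∃[ q' ] (q —[ a ]→ q' × R p' q'))
    × (∀ b → pol b ≡ l → ∀ q' → q —[ b ]→ q' → ∃[ p' ] (p —[ b ]→ p' × R p' q'))

  _≲cc_ : Proc → Proc → Set₁
  p ≲cc q = Σ (Proc → Proc → Set) λ R → IsCCSim R × R p q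

  data Form : Set where
    ⊥F ⊤F   : Form
    _∧F_ _∨F_ : Form → Form → Form
    box     : (b : Act) → pol b ≡ l → Form → Form
    dia     : (a : Act) → pol a ≡ r → Form → Form

  _⊨_ : Proc → Form → Set
  p ⊨ ⊥F = Empty
  p ⊨ ⊤F = ⊤
  p ⊨ (φ ∧F ψ) = (p ⊨ φ) × (p ⊨ ψ)
  p ⊨ (φ ∨F ψ) = (p ⊨ φ) ⊎ (p ⊨ ψ)
  p ⊨ box b _ φ = ∀ p' → p —[ b ]→ p' → p' ⊨ φ
  p ⊨ dia a _ φ = ∃[ p' ] (p —[ a ]→ p' × p' ⊨ φ)

  _≡L_ : Form → Form → Set
  φ ≡L ψ = ∀ q → (q ⊨ φ) ⇔ (q ⊨ ψ)

  IsCharFormula : Form → Proc → Set₁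
  IsCharFormula φ p = (p ⊨ φ) × (∀ q → q ⊨ φ → p ≲cc q)

  RepresentedBy : Form → Proc → Set₁
  RepresentedBy φ p = ∀ q → (q ⊨ φ) ⇔ (p ≲cc q)

  RepresentedBySet : Form → List Proc → Set₁
  RepresentedBySet φ M = ∀ q → (q ⊨ φ) ⇔ (∃[ p ] (p ∈ M × p ≲cc q))

  ⋁ : List Form → Form
  ⋁ = foldr _∨F_ ⊥F

module Submission where

-- Say that a formula φ *defines* a predicate S on processes when
-- q ⊨ φ holds exactly for the q with S q.  Then "p represents φ" means
-- that φ defines the up-set  { q | p ≲cc q },  and "M represents φ" means
-- that φ defines the union of the up-sets of the members of M.
--
-- The proof rests on three facts:
--   * satisfaction of L-formulae is preserved along cc-simulations, so a
--     characteristic formula χ p defines exactly the up-set of p;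
--   * a disjunction ⋁ (map f M) defines the union of the predicates the
--     formulae f x (x ∈ M) define; hence ⋁ (map χ M) defines the union
--     of the up-sets of the members of M;
--   * two formulae defining the same predicate are logically equivalent,
--     and conversely any formula equivalent to a defining one defines it.
-- Both parts of the theorem are then instances of the last fact.

open import Defs
open import Data.Nat using (ℕ)
open import Data.Fin using (Fin)
open import Data.List using (List; map; _∷_)
open import Data.List.Membership.Propositional using (_∈_)
open import Data.List.Relation.Unary.Any using (here; there)
open import Data.Product using (_×_; _,_; proj₁; proj₂; ∃-syntax)
open import Data.Sum using (inj₁; inj₂)
open import Function.Bundles using (_⇔_; mk⇔; Equivalence)
import Function.Properties.Equivalence as ⇔
open import Relation.Binary.PropositionalEquality using (refl)

module Representation (n : ℕ) (pol : Fin n → Pol) where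
  open CC n pol
  open Equivalence using (to; from)

  Defines : ∀ {ℓ} → Form → (Proc → Set ℓ) → Set ℓ
  Defines φ S = ∀ q → (q ⊨ φ) ⇔ S q

  -- Every formula of L is upward closed along cc-simulations: the
  -- modalities ⟨a⟩ (a ∈ A^r) and [b] (b ∈ A^l) are exactly the ones
  -- whose witnesses a simulation transports from p to q.
  ⊨-preserved : ∀ (R : Proc → Proc → Set) → IsCCSim R →
                ∀ φ {p q} → R p q → p ⊨ φ → q ⊨ φ
  ⊨-preserved R sim ⊤F       Rpq h         = h
  ⊨-preserved R sim (φ ∧F ψ) Rpq (hφ , hψ) =
    ⊨-preserved R sim φ Rpq hφ , ⊨-preserved R sim ψ Rpq hψ
  ⊨-preserved R sim (φ ∨F ψ) Rpq (inj₁ h)  = inj₁ (⊨-preserved R sim φ Rpq h)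
  ⊨-preserved R sim (φ ∨F ψ) Rpq (inj₂ h)  = inj₂ (⊨-preserved R sim ψ Rpq h)
  ⊨-preserved R sim (box b b∈l φ) {p} {q} Rpq h q' q→q'
    with proj₂ (sim p q Rpq) b b∈l q' q→q'
  ... | p' , p→p' , Rp'q' = ⊨-preserved R sim φ Rp'q' (h p' p→p')
  ⊨-preserved R sim (dia a a∈r φ) {p} {q} Rpq (p' , p→p' , h)
    with proj₁ (sim p q Rpq) a a∈r p' p→p'
  ... | q' , q→q' , Rp'q' = q' , q→q' , ⊨-preserved R sim φ Rp'q' h

  char-represents : ∀ {φ p} → IsCharFormula φ p → Defines φ (p ≲cc_)
  char-represents {φ} (p⊨φ , minimal) q =
    mk⇔ (minimal q) (λ (R , sim , Rpq) → ⊨-preserved R sim φ Rpq p⊨φ)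

  ⋁-defines : ∀ {a ℓ} {X : Set a} {f : X → Form} {S : X → Proc → Set ℓ} →
              (∀ x → Defines (f x) (S x)) →
              ∀ xs → Defines (⋁ (map f xs)) (λ q → ∃[ x ] (x ∈ xs × S x q))
  ⋁-defines {f = f} {S} def xs q = mk⇔ (into xs) (outof xs)
    where
    into : ∀ xs → q ⊨ ⋁ (map f xs) → ∃[ x ] (x ∈ xs × S x q)
    into (x ∷ xs) (inj₁ h) = x , here refl , to (def x q) h
    into (x ∷ xs) (inj₂ h) with into xs h
    ... | y , y∈xs , s = y , there y∈xs , s

    outof : ∀ xs → ∃[ x ] (x ∈ xs × S x q) → q ⊨ ⋁ (map f xs)
    outof (x ∷ xs) (.x , here refl   , s) = inj₁ (from (def x q) s)
    outof (x ∷ xs) (y  , there y∈xs , s) = inj₂ (outof xs (y , y∈xs , s))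

  defines⇔≡L : ∀ {ℓ} {ψ} {S : Proc → Set ℓ} → Defines ψ S →
               ∀ φ → Defines φ S ⇔ (φ ≡L ψ)
  defines⇔≡L ψ-def φ = mk⇔
    (λ φ-def q → ⇔.trans (φ-def q) (⇔.sym (ψ-def q)))
    (λ φ≡ψ   q → ⇔.trans (φ≡ψ q) (ψ-def q))

lemma10 : (n : ℕ) (pol : Fin n → Pol) → let open CC n pol in
    (χ : Proc → Form) → (∀ p → IsCharFormula (χ p) p) →
    (∀ (p : Proc) (φ : Form) → RepresentedBy φ p ⇔ (φ ≡L χ p))
    × (∀ (M : List Proc) (φ : Form) → RepresentedBySet φ M ⇔ (φ ≡L ⋁ (map χ M)))
lemma10 n pol χ χ-char =
    (λ p → defines⇔≡L (χ-defines p))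
  , (λ M → defines⇔≡L (⋁-defines χ-defines M))
  where
  open CC n pol
  open Representation n pol
  χ-defines : ∀ p → Defines (χ p) (p ≲cc_)
  χ-defines p = char-represents (χ-char p)
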